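{- Let $m \geq 1$ be an integer. The clique number of the graph $\mathrm{Cay}(\tau_m)$ is at least $2^m$.
   Context: Identify each $i \in \mathbb{Z}_2^{2m}$ with a bit string of length $2m$, read as an $m$-digit base-4 number by grouping consecutive pairs of bits, each pair $(b_{2k+1}, b_{2k})$ giving the base-4 digit $2b_{2k+1}+b_{2k}$. Define $\tau_m:\mathbb{Z}_2^{2m}\to\mathbb{Z}_2$ by $\tau_m(i)=1$ if and only if the number of base-4 digits of $i$ equal to $1$ or $2$ is nonzero and the number of base-4 digits of $i$ equal to $1$ is even. The Cayley graph $\mathrm{Cay}(\tau_m)$ is the simple undirected graph with vertex set $\mathbb{Z}_2^{2m}$ in which distinct vertices $i,j$ are adjacent if and only if $\tau_m(i+j)=1$. -}

module Defs where

open import Data.Bool using (Bool; true; false; _xor_; _∧_; not)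
open import Data.Nat using (ℕ; zero; suc; _+_; _*_; _≟_)
open import Data.Nat.DivMod using (_%_)
open import Data.Vec using (Vec; []; _∷_; zipWith)
open import Data.List using (List)
open import Data.List.Relation.Unary.AllPairs using (AllPairs)
open import Relation.Nullary.Decidable using (does)
open import Relation.Nullary using (¬_)
open import Relation.Binary.PropositionalEquality using (_≡_)
open import Data.Product using (_×_)

-- Elements of Z_2^{2m}: bit strings of length 2m (stored as m * 2 so that
-- consecutive pairs can be split off by pattern matching).
V : ℕ → Set
V m = Vec Bool (m * 2)

_⊕_ : ∀ {m} → V m → V m → V m
_⊕_ = zipWith _xor_

-- A base-4 digit given by a bit pair (b_{2k+1}, b_{2k}) is 2 b_{2k+1} + b_{2k}.
-- It equals 1 iff the pair is (false, true); it equals 2 iff (true, false).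
digitIs1 : Bool → Bool → Bool
digitIs1 hi lo = not hi ∧ lo

digitIs2 : Bool → Bool → Bool
digitIs2 hi lo = hi ∧ not lo

b2n : Bool → ℕ
b2n true = 1
b2n false = 0

count1 : ∀ m → V m → ℕ
count1 zero [] = 0
count1 (suc m) (hi ∷ lo ∷ v) = b2n (digitIs1 hi lo) + count1 m v

count12 : ∀ m → V m → ℕ
count12 zero [] = 0
count12 (suc m) (hi ∷ lo ∷ v) =
  b2n (digitIs1 hi lo) + b2n (digitIs2 hi lo) + count12 m v

τ : ∀ m → V m → Bool
τ m i = not (does (count12 m i ≟ 0)) ∧ does (count1 m i % 2 ≟ 0)

Adjacent : ∀ m → V m → V m → Set
Adjacent m i j = (¬ (i ≡ j)) × (τ m (_⊕_ {m} i j) ≡ true)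

IsClique : ∀ m → List (V m) → Set
IsClique m = AllPairs (Adjacent m)

-- The vectors all of whose base-4 digits lie in {0, 2} form a subgroup of
-- Z_2^{2m} of order 2^m, the image of Z_2^m under b ↦ digitwise 2b. A nonzero
-- element of this subgroup has no digit 1 and at least one digit 2, so τ_m is 1
-- on it; hence any two distinct elements of the subgroup are adjacent.
module Submission where

open import Defs
open import Data.Bool using (Bool; true; false; _xor_)
open import Data.Bool.Properties using (xor-same)
open import Data.Nat using (ℕ; suc; _≤_; _^_; _+_; _*_)
open import Data.Nat.Properties using (≤-reflexive; +-identityʳ)
open import Data.List using (List; []; _∷_; map; _++_; length)
open import Data.List.Properties using (length-++; length-map)
open import Data.List.Relation.Unary.All using ([]; universal)
import Data.List.Relation.Unary.All.Properties as All
open import Data.List.Relation.Unary.AllPairs as AllPairs using (AllPairs; []; _∷_)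
import Data.List.Relation.Unary.AllPairs.Properties as AllPairs
open import Data.Vec using (Vec; []; _∷_; zipWith; replicate)
open import Data.Vec.Properties using (∷-injectiveˡ; ∷-injectiveʳ)
open import Function using (_∘_)
open import Data.Product using (Σ; _×_; _,_)
open import Relation.Nullary using (contradiction)
open import Relation.Binary.PropositionalEquality

allVecs : ∀ n → List (Vec Bool n)
allVecs 0       = [] ∷ []
allVecs (suc n) = map (false ∷_) (allVecs n) ++ map (true ∷_) (allVecs n)

length-allVecs : ∀ n → length (allVecs n) ≡ 2 ^ n
length-allVecs 0       = refl
length-allVecs (suc n) = begin
  length (map (false ∷_) (allVecs n) ++ map (true ∷_) (allVecs n))
    ≡⟨ length-++ (map (false ∷_) (allVecs n)) ⟩
  length (map (false ∷_) (allVecs n)) + length (map (true ∷_) (allVecs n))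
    ≡⟨ cong₂ _+_ (length-map (false ∷_) (allVecs n)) (length-map (true ∷_) (allVecs n)) ⟩
  length (allVecs n) + length (allVecs n)
    ≡⟨ cong (λ k → k + k) (length-allVecs n) ⟩
  2 ^ n + 2 ^ n
    ≡⟨ cong (2 ^ n +_) (sym (+-identityʳ (2 ^ n))) ⟩
  2 ^ suc n ∎
  where open ≡-Reasoning

allVecs-distinct : ∀ n → AllPairs (λ x y → x ≢ y) (allVecs n)
allVecs-distinct 0       = [] ∷ []
allVecs-distinct (suc n) = AllPairs.++⁺
  (AllPairs.map⁺ (AllPairs.map (λ x≢y → x≢y ∘ ∷-injectiveʳ) (allVecs-distinct n)))
  (AllPairs.map⁺ (AllPairs.map (λ x≢y → x≢y ∘ ∷-injectiveʳ) (allVecs-distinct n)))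
  (All.map⁺ (universal (λ _ → All.map⁺ (universal (λ _ ()) _)) _))

⊕-self : ∀ {n} (x : Vec Bool n) → zipWith _xor_ x x ≡ replicate n false
⊕-self []       = refl
⊕-self (a ∷ x) = cong₂ _∷_ (xor-same a) (⊕-self x)

⊕≡replicate-false⇒≡ : ∀ {n} (x y : Vec Bool n) →
  zipWith _xor_ x y ≡ replicate n false → x ≡ y
⊕≡replicate-false⇒≡ []      []      _  = refl
⊕≡replicate-false⇒≡ (a ∷ x) (b ∷ y) eq =
  cong₂ _∷_ (xor≡false⇒≡ a b (∷-injectiveˡ eq)) (⊕≡replicate-false⇒≡ x y (∷-injectiveʳ eq))
  where
  xor≡false⇒≡ : ∀ a b → a xor b ≡ false → a ≡ b
  xor≡false⇒≡ false false _ = refl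
  xor≡false⇒≡ true  true  _ = refl

count12-replicate-false : ∀ m → count12 m (replicate (m * 2) false) ≡ 0
count12-replicate-false 0       = refl
count12-replicate-false (suc m) = count12-replicate-false m

τ-replicate-false : ∀ m → τ m (replicate (m * 2) false) ≡ false
τ-replicate-false m rewrite count12-replicate-false m = refl

τ⇒Adjacent : ∀ m (i j : V m) → τ m (_⊕_ {m} i j) ≡ true → Adjacent m i j
τ⇒Adjacent m i j τ≡true = i≢j , τ≡true
  where
  i≢j : i ≢ j
  i≢j refl with () ← trans (sym τ≡true) (trans (cong (τ m) (⊕-self i)) (τ-replicate-false m))

embed : ∀ {m} → Vec Bool m → V m
embed []      = []
embed (b ∷ w) = b ∷ false ∷ embed w

embed-⊕ : ∀ {m} (x y : Vec Bool m) →
  embed (zipWith _xor_ x y) ≡ _⊕_ {m} (embed x) (embed y)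
embed-⊕ []      []      = refl
embed-⊕ (a ∷ x) (b ∷ y) = cong ((a xor b) ∷_) (cong (false ∷_) (embed-⊕ x y))

count1-embed : ∀ {m} (w : Vec Bool m) → count1 m (embed w) ≡ 0
count1-embed []          = refl
count1-embed (false ∷ w) = count1-embed w
count1-embed (true ∷ w)  = count1-embed w

count12-embed≡0⇒≡replicate-false : ∀ {m} (w : Vec Bool m) →
  count12 m (embed w) ≡ 0 → w ≡ replicate m false
count12-embed≡0⇒≡replicate-false []          _  = refl
count12-embed≡0⇒≡replicate-false (false ∷ w) eq =
  cong (false ∷_) (count12-embed≡0⇒≡replicate-false w eq)
count12-embed≡0⇒≡replicate-false (true ∷ w)  ()

τ-embed : ∀ {m} (w : Vec Bool m) → w ≢ replicate m false → τ m (embed w) ≡ true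
τ-embed {m} w w≢0 rewrite count1-embed w with count12 m (embed w) in c≡
... | 0     = contradiction (count12-embed≡0⇒≡replicate-false w c≡) w≢0
... | suc _ = refl

embed-adjacent : ∀ {m} {x y : Vec Bool m} → x ≢ y → Adjacent m (embed x) (embed y)
embed-adjacent {m} {x} {y} x≢y = τ⇒Adjacent m (embed x) (embed y) (begin
  τ m (_⊕_ {m} (embed x) (embed y)) ≡⟨ cong (τ m) (embed-⊕ x y) ⟨
  τ m (embed (zipWith _xor_ x y))   ≡⟨ τ-embed (zipWith _xor_ x y) (x≢y ∘ ⊕≡replicate-false⇒≡ x y) ⟩
  true                              ∎)
  where open ≡-Reasoning

lemma4 : (m : ℕ) → 1 ≤ m →
    Σ _ (λ C → IsClique m C × 2 ^ m ≤ length C)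
lemma4 m _ =
  map embed (allVecs m) ,
  AllPairs.map⁺ (AllPairs.map embed-adjacent (allVecs-distinct m)) ,
  ≤-reflexive (sym (trans (length-map embed (allVecs m)) (length-allVecs m)))
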